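{- Let $B_n$ be the bouquet with signed rotation $[1,2,\cdots,n,1,2,\cdots,n]$ and let $A=\{i_1,\dots,i_k\}\subseteq\{1,\dots,n\}$ with $k\geq 1$. Then $f\big((B_n)^{\times|A}\big)=k$.
   Context: A bouquet is a ribbon graph with exactly one vertex disc, its edges being loops; $f(B)$ denotes the number of boundary components. A signed rotation of a bouquet is the cyclic ordering of the loop ends around the vertex, where an orientable (untwisted) loop has both ends with the same sign and a non-orientable (twisted) loop has ends with opposite signs; $+$ is omitted. Thus $[1,2,\dots,n,1,2,\dots,n]$ is the bouquet with $n$ pairwise interlaced orientable loops. For a set $A$ of edges, the partial Petrial $B^{\times|A}$ is obtained by adding a half-twist to each edge of $A$; in the signed rotation this toggles the sign of one end of each loop in $A$. -}

module Defs where

open import Data.Nat using (ℕ; zero; suc; _*_; _<?_; s≤s)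
open import Data.Fin using (Fin; zero; suc; toℕ; fromℕ<; combine; remQuot)
open import Data.Fin.Subset using (Subset)
open import Data.Vec using (lookup)
open import Data.Bool using (Bool; true; false; not; if_then_else_; _xor_)
open import Data.Product using (Σ; _×_; _,_; ∃; uncurry)
open import Relation.Nullary using (yes; no)
open import Relation.Binary.PropositionalEquality using (_≡_)
open import Relation.Binary.Construct.Closure.Symmetric using (SymClosure)
open import Relation.Binary.Construct.Closure.ReflexiveTransitive using (Star)

-- The 2n loop ends sit at positions Fin (2 * n) in cyclic order around the vertex.
-- A loop end is (which end ∈ Fin 2 , which loop ∈ Fin n).
-- posOf gives the position of each end; endAt is its inverse (so it is a bijection).
-- sign gives the sign of each end (true = +, false = -).
record SignedRotation (n : ℕ) : Set where
  field
    posOf   : Fin 2 × Fin n → Fin (2 * n)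
    endAt   : Fin (2 * n) → Fin 2 × Fin n
    pos-end : ∀ p → posOf (endAt p) ≡ p
    end-pos : ∀ x → endAt (posOf x) ≡ x
    sign    : Fin 2 × Fin n → Bool
open SignedRotation public

next : ∀ {m} → Fin m → Fin m
next {zero} ()
next {suc m} i with suc (toℕ i) <? suc m
... | yes lt = fromℕ< lt
... | no _  = zero

-- The two ends (corners) of the attaching interval of a loop end on the vertex
-- boundary: L is the end met first going along the cyclic order, R the second.
data Side : Set where
  L R : Side

flipSide : Side → Side
flipSide L = R
flipSide R = L

Corner : ℕ → Set
Corner n = Fin (2 * n) × Side

-- Boundary of the ribbon graph: union of
--  * vertex-boundary arcs between consecutive attaching intervals, joining (p , R) to (next p , L);
--  * the two sides of each edge ribbon. For loop e with ends at positions p (end 0), q (end 1):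
--    equal signs (untwisted band)   : (p , L) -- (q , R) and (p , R) -- (q , L);
--    opposite signs (twisted band)  : (p , L) -- (q , L) and (p , R) -- (q , R).
data BoundaryStep {n : ℕ} (B : SignedRotation n) : Corner n → Corner n → Set where
  arc  : ∀ p → BoundaryStep B (p , R) (next p , L)
  band : ∀ e s →
    BoundaryStep B (posOf B (zero , e) , s)
                   (posOf B (suc zero , e) ,
                     (if sign B (zero , e) xor sign B (suc zero , e) then s else flipSide s))

SameBoundary : ∀ {n} → SignedRotation n → Corner n → Corner n → Set
SameBoundary B = Star (SymClosure (BoundaryStep B))

-- f(B) = k : the boundary components are exactly k in number, i.e. there is a
-- surjective labelling of corners by Fin k whose fibres are exactly the components.
HasBoundaryComponents : ∀ {n} → SignedRotation n → ℕ → Set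
HasBoundaryComponents {n} B k =
  Σ (Corner n → Fin k) λ c →
    (∀ j → ∃ λ v → c v ≡ j) ×
    (∀ v w → c v ≡ c w → SameBoundary B v w) ×
    (∀ v w → SameBoundary B v w → c v ≡ c w)

-- B_n = [1,2,…,n,1,2,…,n], all loops orientable (all signs +):
-- end i of loop j sits at position i * n + j.
Bn : ∀ n → SignedRotation n
Bn n = record
  { posOf   = uncurry combine
  ; endAt   = remQuot n
  ; pos-end = Data.Fin.Properties.combine-remQuot {2} n
  ; end-pos = λ { (i , j) → Data.Fin.Properties.remQuot-combine i j }
  ; sign    = λ _ → true
  }
  where import Data.Fin.Properties

-- partial Petrial (membership e ∈ A is lookup A e ≡ true): toggle the sign of one end (end 1) of each loop in A
partialPetrial : ∀ {n} → SignedRotation n → Subset n → SignedRotation n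
partialPetrial B A = record B
  { sign = λ { (zero , e) → sign B (zero , e)
             ; (suc zero , e) → if lookup A e then not (sign B (suc zero , e)) else sign B (suc zero , e)
             } }

{-# OPTIONS --safe #-}
-- Number the 2n loop ends of Bₙ by ℕ modulo 2n, so that loop x mod n has its ends at x and
-- n + x, and let #A x count the positions below x whose loop is in A (twisted). Label the gap
-- in front of position x by #A x mod |A|. Arcs stay within a gap; a twisted band joins gap x
-- to gap n + x and an untwisted one joins gap x to gap n + x + 1, and in both cases #A grows by
-- exactly |A|, so the label is constant on boundary components.
-- Conversely, a twisted band joins a gap to its antipode n positions on, and untwisted bands
-- carry this back to the earlier gaps; as A ≠ ∅, every gap is joined to its antipode. Through
-- the antipode an untwisted band joins gap x to gap x + 1, so gaps with equal count are joined,
-- and shifting by multiples of n (which shifts the count by multiples of |A|) joins gaps with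
-- equal label.
module Submission where

open import Defs
open import Data.Nat using (ℕ; _≤_)
open import Data.Fin.Subset using (Subset; ∣_∣)

open import Data.Bool using (Bool; true; false; not; if_then_else_; _xor_)
open import Data.Empty using (⊥-elim)
open import Data.Fin as Fin using (Fin; toℕ)
open import Data.Fin.Properties using (toℕ-injective; toℕ-fromℕ<; toℕ<n; toℕ-combine)
open import Data.Fin.Subset.Properties using (∣p∣≤n)
open import Data.Nat using (zero; suc; _+_; _*_; _∸_; _<_; _<?_; NonZero; >-nonZero; >-nonZero⁻¹)
open import Data.Nat.DivMod
open import Data.Nat.Properties
open import Algebra.Properties.CommutativeSemigroup +-commutativeSemigroup using (x∙yz≈z∙yx)
open import Data.Product using (∃; _,_)
open import Data.Sum using (inj₁; inj₂)
open import Data.Vec using (Vec; _∷_; []; lookup)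
open import Function using (_∘_)
open import Relation.Binary.PropositionalEquality
open import Relation.Binary.Construct.Closure.Equivalence using (gfold; return) renaming (setoid to eqClosure-setoid)
open import Relation.Binary.Bundles using (Setoid)
import Relation.Binary.Reasoning.Setoid as SetoidReasoning
open import Relation.Nullary using (yes; no)

mod-toℕ : ∀ {M} .{{_ : NonZero M}} (p : Fin M) → toℕ p mod M ≡ p
mod-toℕ p = toℕ-injective (trans (toℕ-fromℕ< _) (m<n⇒m%n≡m (toℕ<n p)))

%≡⇒mod≡ : ∀ {x y M} .{{_ : NonZero M}} → x % M ≡ y % M → x mod M ≡ y mod M
%≡⇒mod≡ eq = toℕ-injective (trans (toℕ-fromℕ< _) (trans eq (sym (toℕ-fromℕ< _))))

mod≡⇒%≡ : ∀ {x y M} .{{_ : NonZero M}} → x mod M ≡ y mod M → x % M ≡ y % M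
mod≡⇒%≡ eq = trans (sym (toℕ-fromℕ< _)) (trans (cong toℕ eq) (toℕ-fromℕ< _))

[1+m%n]%n≡[1+m]%n : ∀ x M .{{_ : NonZero M}} → suc (x % M) % M ≡ suc x % M
[1+m%n]%n≡[1+m]%n x M = begin
  (1 + x % M) % M            ≡⟨ %-distribˡ-+ 1 (x % M) M ⟩
  (1 % M + x % M % M) % M    ≡⟨ cong (λ r → (1 % M + r) % M) (m%n%n≡m%n x M) ⟩
  (1 % M + x % M) % M        ≡⟨ %-distribˡ-+ 1 x M ⟨
  (1 + x) % M                ∎
  where open ≡-Reasoning

next≡suc-mod : ∀ {M} .{{_ : NonZero M}} (p : Fin M) → next p ≡ suc (toℕ p) mod M
next≡suc-mod {suc M} p with suc (toℕ p) <? suc M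
... | yes lt = toℕ-injective (trans (toℕ-fromℕ< lt) (sym (trans (toℕ-fromℕ< _) (m<n⇒m%n≡m lt))))
... | no ¬lt = toℕ-injective (sym (trans (toℕ-fromℕ< _) (trans (cong (_% suc M) wrap) (n%n≡0 (suc M)))))
  where
  wrap : suc (toℕ p) ≡ suc M
  wrap = ≤-antisym (toℕ<n p) (≮⇒≥ ¬lt)

countBelow : (ℕ → Bool) → ℕ → ℕ
countBelow a zero    = 0
countBelow a (suc x) = if a x then suc (countBelow a x) else countBelow a x

countBelow-cong : ∀ {a b} → (∀ i → a i ≡ b i) → ∀ x → countBelow a x ≡ countBelow b x
countBelow-cong a≗b zero = refl
countBelow-cong a≗b (suc x) rewrite a≗b x | countBelow-cong a≗b x = refl

module _ {a : ℕ → Bool} where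

  countBelow-+ : ∀ y x → countBelow a (y + x) ≡ countBelow a y + countBelow (λ i → a (y + i)) x
  countBelow-+ y zero rewrite +-identityʳ y = sym (+-identityʳ _)
  countBelow-+ y (suc x) rewrite +-suc y x with a (y + x)
  ... | true  = trans (cong suc (countBelow-+ y x)) (sym (+-suc _ _))
  ... | false = countBelow-+ y x

  countBelow-suc-false : ∀ {x} → a x ≡ false → countBelow a (suc x) ≡ countBelow a x
  countBelow-suc-false ax rewrite ax = refl

  countBelow-mono : ∀ {x y} → x ≤ y → countBelow a x ≤ countBelow a y
  countBelow-mono {x} x≤y with m≤n⇒∃[o]m+o≡n x≤y
  ... | d , refl = subst (countBelow a x ≤_) (sym (countBelow-+ x d)) (m≤m+n _ _)

  countBelow-periodic : ∀ {n} → (∀ i → a (n + i) ≡ a i) →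
                        ∀ q x → countBelow a (q * n + x) ≡ q * countBelow a n + countBelow a x
  countBelow-periodic per zero x = refl
  countBelow-periodic {n} per (suc q) x = begin
    countBelow a (n + q * n + x)
      ≡⟨ cong (countBelow a) (+-assoc n (q * n) x) ⟩
    countBelow a (n + (q * n + x))
      ≡⟨ countBelow-+ n (q * n + x) ⟩
    countBelow a n + countBelow (λ i → a (n + i)) (q * n + x)
      ≡⟨ cong (countBelow a n +_) (countBelow-cong per (q * n + x)) ⟩
    countBelow a n + countBelow a (q * n + x)
      ≡⟨ cong (countBelow a n +_) (countBelow-periodic per q x) ⟩
    countBelow a n + (q * countBelow a n + countBelow a x)
      ≡⟨ +-assoc (countBelow a n) _ _ ⟨
    countBelow a n + q * countBelow a n + countBelow a x
      ∎
    where open ≡-Reasoning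

  countBelow-positive : ∀ x → 0 < countBelow a x → ∃ λ i → a i ≡ true
  countBelow-positive (suc x) pos with a x in ax
  ... | true  = x , ax
  ... | false = countBelow-positive x pos

  countBelow-intermediate : ∀ {j} x → j < countBelow a x → ∃ λ y → countBelow a y ≡ j
  countBelow-intermediate (suc x) j<c with a x
  ... | false = countBelow-intermediate x j<c
  ... | true with m≤n⇒m<n∨m≡n (≤-pred j<c)
  ...   | inj₁ j<c′ = countBelow-intermediate x j<c′
  ...   | inj₂ refl = x , refl

countBelow-lookup : ∀ {n} (v : Vec Bool n) {a} → (∀ e → a (toℕ e) ≡ lookup v e) → countBelow a n ≡ ∣ v ∣
countBelow-lookup [] _ = refl
countBelow-lookup {suc n} (b ∷ v) {a} a≗v = begin
  countBelow a (1 + n)                                ≡⟨ countBelow-+ 1 n ⟩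
  countBelow a 1 + countBelow (λ i → a (suc i)) n     ≡⟨ cong₂ _+_ (cong (λ c → if c then 1 else 0) (a≗v Fin.zero))
                                                                   (countBelow-lookup v (a≗v ∘ Fin.suc)) ⟩
  (if b then 1 else 0) + ∣ v ∣                        ≡⟨ head-count b ⟩
  ∣ b ∷ v ∣                                           ∎
  where
  open ≡-Reasoning
  head-count : ∀ b → (if b then 1 else 0) + ∣ v ∣ ≡ ∣ b ∷ v ∣
  head-count true  = refl
  head-count false = refl

residue-induction : ∀ {n} .{{_ : NonZero n}} (P : ℕ → Set) →
                    (∀ (r : Fin n) → P (toℕ r)) → (∀ x → P x → P (n + x)) → ∀ x → P x
residue-induction {n} P base step x = subst P x≡ (multiples (x / n))
  where
  x≡ : x / n * n + x % n ≡ x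
  x≡ = trans (+-comm _ (x % n)) (sym (m≡m%n+[m/n]*n x n))
  multiples : ∀ q → P (q * n + x % n)
  multiples zero    = subst P (toℕ-fromℕ< _) (base (x mod n))
  multiples (suc q) = subst P (sym (+-assoc n (q * n) (x % n))) (step _ (multiples q))

%≡⇒[n/d]*d+m≡[m/d]*d+n : ∀ {m n d} .{{_ : NonZero d}} → m % d ≡ n % d → n / d * d + m ≡ m / d * d + n
%≡⇒[n/d]*d+m≡[m/d]*d+n {m} {n} {d} eq = begin
  n / d * d + m                    ≡⟨ cong (n / d * d +_) (m≡m%n+[m/n]*n m d) ⟩
  n / d * d + (m % d + m / d * d)  ≡⟨ cong (λ r → n / d * d + (r + m / d * d)) eq ⟩
  n / d * d + (n % d + m / d * d)  ≡⟨ x∙yz≈z∙yx (n / d * d) (n % d) (m / d * d) ⟩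
  m / d * d + (n % d + n / d * d)  ≡⟨ cong (m / d * d +_) (m≡m%n+[m/n]*n n d) ⟨
  m / d * d + n                    ∎
  where open ≡-Reasoning

bandSide : Bool → Side → Side
bandSide true  s = s
bandSide false s = flipSide s

bandSide-involutive : ∀ b s → bandSide b (bandSide b s) ≡ s
bandSide-involutive true  s = refl
bandSide-involutive false L = refl
bandSide-involutive false R = refl

module PetrialOfInterlacedBouquet {n : ℕ} {{_ : NonZero n}} (A : Subset n) {{_ : NonZero ∣ A ∣}} where

  instance
    2n-nonZero : NonZero (2 * n)
    2n-nonZero = m*n≢0 2 n

  B : SignedRotation n
  B = partialPetrial (Bn n) A

  _≈_ : Corner n → Corner n → Set
  _≈_ = SameBoundary B

  module ≈ = Setoid (eqClosure-setoid (BoundaryStep B))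
  module ≈-Reasoning = SetoidReasoning (eqClosure-setoid (BoundaryStep B))

  twisted : ℕ → Bool
  twisted x = lookup A (x mod n)

  twisted-toℕ : ∀ e → twisted (toℕ e) ≡ lookup A e
  twisted-toℕ e = cong (lookup A) (mod-toℕ e)

  twisted-periodic : ∀ x → twisted (n + x) ≡ twisted x
  twisted-periodic x = cong (lookup A) (%≡⇒mod≡ (trans (cong (_% n) (+-comm n x)) ([m+n]%n≡m%n x n)))

  #A : ℕ → ℕ
  #A = countBelow twisted

  #A-n : #A n ≡ ∣ A ∣
  #A-n = countBelow-lookup A twisted-toℕ

  #A-periodic : ∀ q x → #A (q * n + x) ≡ q * ∣ A ∣ + #A x
  #A-periodic q x = trans (countBelow-periodic twisted-periodic q x) (cong (λ k → q * k + #A x) #A-n)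

  corner : ℕ → Side → Corner n
  corner x s = x mod (2 * n) , s

  corner-toℕ : ∀ p s → corner (toℕ p) s ≡ (p , s)
  corner-toℕ p s = cong (_, s) (mod-toℕ p)

  corner-2n-periodic : ∀ x s → corner (n + (n + x)) s ≡ corner x s
  corner-2n-periodic x s =
    cong (_, s) (%≡⇒mod≡ (trans (cong (_% (2 * n)) n+[n+x]≡x+2n) ([m+n]%n≡m%n x (2 * n))))
    where
    n+[n+x]≡x+2n : n + (n + x) ≡ x + 2 * n
    n+[n+x]≡x+2n = trans (sym (+-assoc n n x))
                         (trans (+-comm (n + n) x) (cong (λ m → x + (n + m)) (sym (+-identityʳ n))))

  gapAt : ℕ → Side → ℕ
  gapAt x L = x
  gapAt x R = suc x

  gap : Corner n → ℕ
  gap (p , s) = gapAt (toℕ p) s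

  toℕ-end₀ : ∀ e → toℕ (posOf B (Fin.zero , e)) ≡ toℕ e
  toℕ-end₀ e = trans (toℕ-combine {2} Fin.zero e) (cong (_+ toℕ e) (*-zeroʳ n))

  toℕ-end₁ : ∀ e → toℕ (posOf B (Fin.suc Fin.zero , e)) ≡ n + toℕ e
  toℕ-end₁ e = trans (toℕ-combine {2} (Fin.suc Fin.zero) e) (cong (_+ toℕ e) (*-identityʳ n))

  crossedSide : Fin n → Side → Side
  crossedSide e s = if sign B (Fin.zero , e) xor sign B (Fin.suc Fin.zero , e) then s else flipSide s

  crossedSide≡bandSide : ∀ e s → crossedSide e s ≡ bandSide (twisted (toℕ e)) s
  crossedSide≡bandSide e s = trans (petrial-side (lookup A e)) (cong (λ b → bandSide b s) (sym (twisted-toℕ e)))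
    where
    petrial-side : ∀ b → (if true xor (if b then not true else true) then s else flipSide s) ≡ bandSide b s
    petrial-side true  = refl
    petrial-side false = refl

  arcAt : ∀ x → corner x R ≈ corner (suc x) L
  arcAt x = subst (λ p → corner x R ≈ (p , L)) next-corner (return (arc (x mod (2 * n))))
    where
    next-corner : next (x mod (2 * n)) ≡ suc x mod (2 * n)
    next-corner = trans (next≡suc-mod _)
      (%≡⇒mod≡ (trans (cong (λ r → suc r % (2 * n)) (toℕ-fromℕ< _)) ([1+m%n]%n≡[1+m]%n x (2 * n))))

  bandAt-loop : ∀ (e : Fin n) s → corner (toℕ e) s ≈ corner (n + toℕ e) (bandSide (twisted (toℕ e)) s)
  bandAt-loop e s = subst₂ _≈_ end₀ end₁ (return (band e s))
    where
    end₀ : (posOf B (Fin.zero , e) , s) ≡ corner (toℕ e) s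
    end₀ = trans (sym (corner-toℕ _ s)) (cong (λ x → corner x s) (toℕ-end₀ e))
    end₁ : (posOf B (Fin.suc Fin.zero , e) , crossedSide e s) ≡ corner (n + toℕ e) (bandSide (twisted (toℕ e)) s)
    end₁ = trans (sym (corner-toℕ _ _)) (cong₂ corner (toℕ-end₁ e) (crossedSide≡bandSide e s))

  bandAt : ∀ x s → corner x s ≈ corner (n + x) (bandSide (twisted x) s)
  bandAt = residue-induction _ bandAt-loop shift
    where
    shift : ∀ x → (∀ s → corner x s ≈ corner (n + x) (bandSide (twisted x) s)) →
            ∀ s → corner (n + x) s ≈ corner (n + (n + x)) (bandSide (twisted (n + x)) s)
    shift x band-x s = begin
      corner (n + x) s                                  ≡⟨ cong (corner (n + x)) (bandSide-involutive b s) ⟨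
      corner (n + x) (bandSide b (bandSide b s))        ≈⟨ band-x (bandSide b s) ⟨
      corner x (bandSide b s)                           ≡⟨ corner-2n-periodic x _ ⟨
      corner (n + (n + x)) (bandSide b s)               ≡⟨ cong (λ b′ → corner _ (bandSide b′ s)) (twisted-periodic x) ⟨
      corner (n + (n + x)) (bandSide (twisted (n + x)) s) ∎
      where
      open ≈-Reasoning
      b = twisted x

  twisted-band : ∀ {x} → twisted x ≡ true → ∀ s → corner x s ≈ corner (n + x) s
  twisted-band {x} tw s = subst (λ b → corner x s ≈ corner (n + x) (bandSide b s)) tw (bandAt x s)

  untwisted-band : ∀ {x} → twisted x ≡ false → ∀ s → corner x s ≈ corner (n + x) (flipSide s)
  untwisted-band {x} ut s = subst (λ b → corner x s ≈ corner (n + x) (bandSide b s)) ut (bandAt x s)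

  untwisted⇒gap≈antipode-of-suc : ∀ {x} → twisted x ≡ false → corner x L ≈ corner (n + suc x) L
  untwisted⇒gap≈antipode-of-suc {x} ut = begin
    corner x L             ≈⟨ untwisted-band ut L ⟩
    corner (n + x) R       ≈⟨ arcAt (n + x) ⟩
    corner (suc (n + x)) L ≡⟨ cong (λ y → corner y L) (+-suc n x) ⟨
    corner (n + suc x) L   ∎
    where open ≈-Reasoning

  untwisted⇒suc-gap≈antipode : ∀ {x} → twisted x ≡ false → corner (suc x) L ≈ corner (n + x) L
  untwisted⇒suc-gap≈antipode {x} ut = ≈.trans (≈.sym (arcAt x)) (untwisted-band ut R)

  gap≈antipode-before-twisted : ∀ d x → twisted (d + x) ≡ true → corner x L ≈ corner (n + x) L
  gap≈antipode-before-twisted zero    x tw = twisted-band tw L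
  gap≈antipode-before-twisted (suc d) x tw with twisted x in tx
  ... | true  = twisted-band tx L
  ... | false = begin
    corner x L           ≈⟨ untwisted⇒gap≈antipode-of-suc tx ⟩
    corner (n + suc x) L ≈⟨ gap≈antipode-before-twisted d (suc x) (trans (cong twisted (+-suc d x)) tw) ⟨
    corner (suc x) L     ≈⟨ untwisted⇒suc-gap≈antipode tx ⟩
    corner (n + x) L     ∎
    where open ≈-Reasoning

  gap≈antipode : ∀ x → corner x L ≈ corner (n + x) L
  gap≈antipode x with countBelow-positive n (subst (0 <_) (sym #A-n) (>-nonZero⁻¹ ∣ A ∣))
  ... | a , tw = gap≈antipode-before-twisted (z ∸ x) x twisted-[z∸x+x]
    where
    z : ℕ
    z = a + x * n
    x≤z : x ≤ z
    x≤z = ≤-trans (m≤m*n x n) (m≤n+m _ a)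
    twisted-[z∸x+x] : twisted (z ∸ x + x) ≡ true
    twisted-[z∸x+x] = trans (cong twisted (m∸n+n≡m x≤z)) (trans (cong (lookup A) (%≡⇒mod≡ ([m+kn]%n≡m%n a x n))) tw)

  gap≈shift : ∀ q x → corner x L ≈ corner (q * n + x) L
  gap≈shift zero    x = ≈.refl
  gap≈shift (suc q) x = begin
    corner x L                 ≈⟨ gap≈shift q x ⟩
    corner (q * n + x) L       ≈⟨ gap≈antipode (q * n + x) ⟩
    corner (n + (q * n + x)) L ≡⟨ cong (λ y → corner y L) (+-assoc n (q * n) x) ⟨
    corner (n + q * n + x) L   ∎
    where open ≈-Reasoning

  gap≈suc : ∀ {x} → twisted x ≡ false → corner x L ≈ corner (suc x) L
  gap≈suc {x} ut = ≈.trans (untwisted⇒gap≈antipode-of-suc ut) (≈.sym (gap≈antipode (suc x)))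

  gap≈gap-above : ∀ d x → #A x ≡ #A (d + x) → corner x L ≈ corner (d + x) L
  gap≈gap-above zero    x _    = ≈.refl
  gap≈gap-above (suc d) x same with twisted (d + x) in t
  ... | false = ≈.trans (gap≈gap-above d x same) (gap≈suc t)
  ... | true  = ⊥-elim (1+n≰n (subst (_≤ #A (d + x)) same (countBelow-mono (m≤n+m x d))))

  gap≈gap-ordered : ∀ {x y} → x ≤ y → #A x ≡ #A y → corner x L ≈ corner y L
  gap≈gap-ordered {x} {y} x≤y same = subst (λ z → corner x L ≈ corner z L) (m∸n+n≡m x≤y)
    (gap≈gap-above (y ∸ x) x (trans same (cong #A (sym (m∸n+n≡m x≤y)))))

  gap≈gap-same-count : ∀ {x y} → #A x ≡ #A y → corner x L ≈ corner y L
  gap≈gap-same-count {x} {y} same with ≤-total x y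
  ... | inj₁ x≤y = gap≈gap-ordered x≤y same
  ... | inj₂ y≤x = ≈.sym (gap≈gap-ordered y≤x (sym same))

  label : ℕ → Fin ∣ A ∣
  label x = #A x mod ∣ A ∣

  label-shift : ∀ q x → label (q * n + x) ≡ label x
  label-shift q x = %≡⇒mod≡ (begin
    #A (q * n + x) % ∣ A ∣      ≡⟨ cong (_% ∣ A ∣) (trans (#A-periodic q x) (+-comm (q * ∣ A ∣) (#A x))) ⟩
    (#A x + q * ∣ A ∣) % ∣ A ∣  ≡⟨ [m+kn]%n≡m%n (#A x) q ∣ A ∣ ⟩
    #A x % ∣ A ∣                ∎)
    where open ≡-Reasoning

  label-antiperiodic : ∀ x → label (n + x) ≡ label x
  label-antiperiodic x = trans (cong (λ m → label (m + x)) (sym (+-identityʳ n))) (label-shift 1 x)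

  label-mod-2n : ∀ x → label (x % (2 * n)) ≡ label x
  label-mod-2n x = trans (sym (label-shift (x / (2 * n) * 2) (x % (2 * n)))) (cong label x≡)
    where
    x≡ : x / (2 * n) * 2 * n + x % (2 * n) ≡ x
    x≡ = trans (cong (_+ x % (2 * n)) (*-assoc (x / (2 * n)) 2 n))
               (trans (+-comm (x / (2 * n) * (2 * n)) (x % (2 * n))) (sym (m≡m%n+[m/n]*n x (2 * n))))

  gap≈gap-same-label : ∀ {x y} → label x ≡ label y → corner x L ≈ corner y L
  gap≈gap-same-label {x} {y} eq = begin
    corner x L            ≈⟨ gap≈shift qy x ⟩
    corner (qy * n + x) L ≈⟨ gap≈gap-same-count counts ⟩
    corner (qx * n + y) L ≈⟨ gap≈shift qx y ⟨
    corner y L            ∎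
    where
    open ≈-Reasoning
    qx qy : ℕ
    qx = #A x / ∣ A ∣
    qy = #A y / ∣ A ∣
    counts : #A (qy * n + x) ≡ #A (qx * n + y)
    counts = trans (#A-periodic qy x)
                   (trans (%≡⇒[n/d]*d+m≡[m/d]*d+n (mod≡⇒%≡ eq)) (sym (#A-periodic qx y)))

  ≈corner-gap : ∀ v → v ≈ corner (gap v) L
  ≈corner-gap (p , L) = ≈.reflexive (sym (corner-toℕ p L))
  ≈corner-gap (p , R) = subst (_≈ corner (suc (toℕ p)) L) (corner-toℕ p R) (arcAt (toℕ p))

  component : Corner n → Fin ∣ A ∣
  component v = label (gap v)

  component-complete : ∀ {v w} → component v ≡ component w → v ≈ w
  component-complete {v} {w} eq =
    ≈.trans (≈corner-gap v) (≈.trans (gap≈gap-same-label eq) (≈.sym (≈corner-gap w)))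

  label-across-band : ∀ x s → label (gapAt x s) ≡ label (gapAt (n + x) (bandSide (twisted x) s))
  label-across-band x s with twisted x in t
  ... | true  = sym (trans (cong label (gapAt-+ s)) (label-antiperiodic _))
    where
    gapAt-+ : ∀ s → gapAt (n + x) s ≡ n + gapAt x s
    gapAt-+ L = refl
    gapAt-+ R = sym (+-suc n x)
  ... | false = untwisted s
    where
    label-suc : label (suc x) ≡ label x
    label-suc = cong (_mod ∣ A ∣) (countBelow-suc-false {twisted} t)
    untwisted : ∀ s → label (gapAt x s) ≡ label (gapAt (n + x) (flipSide s))
    untwisted L = sym (trans (cong label (sym (+-suc n x))) (trans (label-antiperiodic (suc x)) label-suc))
    untwisted R = trans label-suc (sym (label-antiperiodic x))

  component-step : ∀ {u v} → BoundaryStep B u v → component u ≡ component v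
  component-step (arc p) = sym (trans (cong label toℕ-next) (label-mod-2n _))
    where
    toℕ-next : toℕ (next p) ≡ suc (toℕ p) % (2 * n)
    toℕ-next = trans (cong toℕ (next≡suc-mod p)) (toℕ-fromℕ< _)
  component-step (band e s) =
    trans (cong (λ x → label (gapAt x s)) (toℕ-end₀ e))
          (trans (label-across-band (toℕ e) s)
                 (sym (cong₂ (λ x s′ → label (gapAt x s′)) (toℕ-end₁ e) (crossedSide≡bandSide e s))))

  component-surjective : ∀ j → ∃ λ v → component v ≡ j
  component-surjective j with countBelow-intermediate n (subst (toℕ j <_) (sym #A-n) (toℕ<n j))
  ... | y , #A-y = corner y L , (begin
    label (toℕ (y mod (2 * n))) ≡⟨ cong label (toℕ-fromℕ< (m%n<n y (2 * n))) ⟩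
    label (y % (2 * n))         ≡⟨ label-mod-2n y ⟩
    #A y mod ∣ A ∣              ≡⟨ cong (_mod ∣ A ∣) #A-y ⟩
    toℕ j mod ∣ A ∣             ≡⟨ mod-toℕ j ⟩
    j                           ∎)
    where open ≡-Reasoning

  boundaryComponents : HasBoundaryComponents B ∣ A ∣
  boundaryComponents = component , component-surjective , (λ _ _ → component-complete) ,
                       (λ _ _ → gfold isEquivalence component component-step)

lemma3p7 : (n : ℕ) (A : Subset n) → 1 ≤ ∣ A ∣ →
    HasBoundaryComponents (partialPetrial (Bn n) A) ∣ A ∣
lemma3p7 n A 1≤∣A∣ = PetrialOfInterlacedBouquet.boundaryComponents A
  where
  instance
    n-nonZero : NonZero n
    n-nonZero = >-nonZero (≤-trans 1≤∣A∣ (∣p∣≤n A))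
    ∣A∣-nonZero : NonZero ∣ A ∣
    ∣A∣-nonZero = >-nonZero 1≤∣A∣
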